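{- For positive integers $r,c,t$, the map $d$ on $\mathcal{C}(r,c,t)$ satisfies $d^2=0$, so $(\mathcal{C}(r,c,t),d)$ is a chain complex.
   Context: $SSYT(r,c,t)$ is the set of $r\times c$ arrays $T=(T_{R,j})$ (rows $R=1,\dots,r$ top to bottom, columns $j=1,\dots,c$) with entries in $\{0,1,\dots,r+t-1\}$, weakly increasing along rows and strictly increasing down columns. It is ranked by $\mathrm{rank}(T)=\|T\|-c\binom{r}{2}$, where $\|T\|$ is the sum of entries. $\mathcal{C}(r,c,t)$ is the $\mathbb{F}_2$-vector space with basis $SSYT(r,c,t)$, graded by rank. For a row $R$ and a value $v$, call an occurrence of $v$ in row $R$ at column $j$ free if $R=1$ or $T_{R-1,j}\neq v-1$. Define $d(T)=\sum T'$, the sum over all pairs $(R,v)$ with $v$ odd, $v$ occurring in row $R$, and the number of free occurrences of $v$ in row $R$ odd, of the tableau $T'$ obtained from $T$ by replacing the leftmost occurrence of $v$ in row $R$ by $v-1$. -}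

module Defs where

open import Data.Bool using (Bool; true; false; if_then_else_; _∧_)
open import Data.Nat using (ℕ; zero; suc; _+_; _∸_; _<_; _≤_; _≡ᵇ_; _%_; _⊔_)
import Data.Nat as ℕ
open import Data.Fin using (Fin; zero; suc; inject₁)
import Data.Fin as Fin
open import Data.Vec using (Vec; []; _∷_; lookup; _[_]≔_; foldr)
open import Data.Vec.Properties using (≡-dec)
open import Data.List using (List; []; _∷_; concatMap; upTo; allFin; [_])
open import Data.Maybe using (Maybe; nothing; just)
open import Data.Product using (_×_)
open import Relation.Nullary using (does)
open import Relation.Binary.PropositionalEquality using (_≡_)

-- An r × c array of natural numbers; row R is  lookup T R , entry (R , j) is
-- lookup (lookup T R) j.  Rows/columns are 0-indexed here (Fin r, Fin c).
Array : ℕ → ℕ → Set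
Array r c = Vec (Vec ℕ c) r

entry : ∀ {r c} → Array r c → Fin r → Fin c → ℕ
entry T R j = lookup (lookup T R) j

IsSSYT : (r c t : ℕ) → Array r c → Set
IsSSYT r c t T =
  (∀ R j → entry T R j < r + t) ×
  (∀ R (j j' : Fin c) → j Fin.≤ j' → entry T R j ≤ entry T R j') ×
  (∀ (R R' : Fin r) j → R Fin.< R' → entry T R j < entry T R' j)

isOdd : ℕ → Bool
isOdd n = (n % 2) ≡ᵇ 1

above : ∀ {r c} → Array r c → Fin r → Maybe (Vec ℕ c)
above T zero = nothing
above (x ∷ xs) (suc i) = just (lookup (x ∷ xs) (inject₁ i))

occ : ∀ {c} → ℕ → Vec ℕ c → ℕ
occ v [] = 0
occ v (x ∷ xs) = (if x ≡ᵇ v then 1 else 0) + occ v xs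

occFreeBelow : ∀ {c} → ℕ → Vec ℕ c → Vec ℕ c → ℕ
occFreeBelow v [] [] = 0
occFreeBelow v (a ∷ as) (x ∷ xs) =
  (if (x ≡ᵇ v) ∧ Data.Bool.not (a ≡ᵇ (v ∸ 1)) then 1 else 0) + occFreeBelow v as xs

freeCount : ∀ {c} → Maybe (Vec ℕ c) → Vec ℕ c → ℕ → ℕ
freeCount nothing  row v = occ v row
freeCount (just a) row v = occFreeBelow v a row

replaceFirst : ∀ {c} → ℕ → ℕ → Vec ℕ c → Vec ℕ c
replaceFirst v w [] = []
replaceFirst v w (x ∷ xs) = if x ≡ᵇ v then w ∷ xs else x ∷ replaceFirst v w xs

rowMax : ∀ {c} → Vec ℕ c → ℕ
rowMax = foldr _ _⊔_ 0

-- d on a basis element, as the list of summands T' (a formal sum over F₂).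
-- Values v range over 0..max(row); values not occurring have 0 free
-- occurrences (even), so they contribute nothing, as in the paper.
dBasis : ∀ {r c} → Array r c → List (Array r c)
dBasis {r} T = concatMap perRow (allFin r)
  where
  perRow : Fin _ → List (Array _ _)
  perRow R = concatMap perVal (upTo (suc (rowMax (lookup T R))))
    where
    perVal : ℕ → List (Array _ _)
    perVal v =
      if isOdd v ∧ isOdd (freeCount (above T R) (lookup T R) v)
      then [ T [ R ]≔ replaceFirst v (v ∸ 1) (lookup T R) ]
      else []

-- Elements of C(r,c,t) are represented as formal sums (lists of basis
-- tableaux); coefficient of U ∈ F₂ is the parity of its multiplicity.
Chain : ℕ → ℕ → Set
Chain r c = List (Array r c)

d : ∀ {r c} → Chain r c → Chain r c
d = concatMap dBasis

multiplicity : ∀ {r c} → Array r c → Chain r c → ℕ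
multiplicity U [] = 0
multiplicity U (T ∷ x) =
  (if does (≡-dec (≡-dec ℕ._≟_) T U) then 1 else 0) + multiplicity U x

IsZeroChain : ∀ {r c} → Chain r c → Set
IsZeroChain {r} {c} x = (U : Array r c) → multiplicity U x % 2 ≡ 0

-- Call p = (R , v) lowerable in T if v is odd and row R has an odd number of
-- free occurrences of v; lowering T along p turns the leftmost v of row R into
-- v - 1, and d T is the sum of the lowerings of T along its lowerable p.
-- Lowering along p changes a single entry from v to v - 1, so by parity the
-- only free counts of odd values it can affect are those of v in rows R and
-- R + 1. The latter would need an entry v above a v, impossible in a
-- column-strict tableau; the former drops by exactly one, because the leftmost
-- v is free (were it below a v - 1, then so would be every later v, the row
-- above being sorted). Hence p is the only move whose lowerability changes, and
-- distinct moves commute. So d (d T) is the sum of lower (lower T p) q over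
-- ordered pairs of distinct lowerable moves, where (p , q) and (q , p)
-- contribute the same tableau: every coefficient is even.

module Submission where

open import Defs
open import Data.Nat using (ℕ; _≥_)
open import Data.List.Relation.Unary.All using (All)

open import Data.Bool using (Bool; true; false; if_then_else_; _∧_; not)
open import Data.Bool.Properties using (not-involutive; ∧-zeroʳ; ∧-conicalˡ; ∧-conicalʳ)
open import Data.Nat using (zero; suc; _+_; _∸_; _<_; _≤_; _≡ᵇ_; z≤n; s≤s)
import Data.Nat as ℕ
open import Data.Nat.Properties
open import Algebra.Properties.CommutativeSemigroup +-commutativeSemigroup
  using () renaming (interchange to +-interchange)
open import Data.Nat.Divisibility using (_∣_; divides; ∣m∣n⇒∣m+n; n∣m⇒m%n≡0)
open import Data.Fin using (Fin; zero; suc; inject₁)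
import Data.Fin as Fin
open import Data.Fin.Properties using (≤̄⇒inject₁<) renaming (≤-refl to ≤ᶠ-refl; <⇒≢ to <⇒≢ᶠ)
open import Data.Vec using (Vec; []; _∷_; lookup; _[_]≔_)
open import Data.Vec.Properties using (lookup∘update; lookup∘update′; []≔-idempotent; []≔-commutes)
open import Data.Vec.Relation.Unary.All using ([]; _∷_) renaming (All to AllV)
open import Data.Vec.Relation.Unary.All.Properties using (lookup⁺; lookup⁻)
open import Data.Vec.Relation.Unary.AllPairs using (AllPairs; []; _∷_)
open import Data.Vec.Relation.Binary.Pointwise.Inductive using (Pointwise; []; _∷_)
open import Data.Vec.Relation.Binary.Pointwise.Extensional using (ext; extensional⇒inductive)
open import Data.List using (List; []; _∷_; _++_; map; concatMap; upTo; allFin; [_]; cartesianProduct)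
open import Data.List.Properties using (upTo-∷ʳ)
import Data.List.Relation.Unary.All as All
open import Data.Maybe using (Maybe; nothing; just)
open import Data.Product using (_×_; _,_; proj₂)
open import Data.Product.Properties using () renaming (≡-dec to ×-≡-dec)
open import Data.Sum using (inj₁; inj₂)
open import Function using (_∘_)
open import Relation.Nullary using (yes; no; contradiction)
open import Relation.Nullary.Reflects using (Reflects; ofʸ; ofⁿ)
open import Relation.Nullary.Decidable using (proof; dec-true; dec-false)
open import Relation.Binary.PropositionalEquality hiding ([_])

private
  variable
    A B : Set

isOdd-suc : ∀ n → isOdd (suc n) ≡ not (isOdd n)
isOdd-suc zero    = refl
isOdd-suc (suc n) rewrite isOdd-suc n = sym (not-involutive (isOdd n))

odd-suc⇒even : ∀ n → isOdd (suc n) ≡ true → isOdd n ≡ false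
odd-suc⇒even n h = begin
  isOdd n               ≡⟨ sym (not-involutive (isOdd n)) ⟩
  not (not (isOdd n))   ≡⟨ cong not (sym (isOdd-suc n)) ⟩
  not (isOdd (suc n))   ≡⟨ cong not h ⟩
  false                 ∎
  where open ≡-Reasoning

odd⇒nonZero : ∀ n → isOdd n ≡ true → 1 ≤ n
odd⇒nonZero (suc n) _ = s≤s z≤n

odd∸1≢odd : ∀ v u → isOdd v ≡ true → isOdd u ≡ true → v ∸ 1 ≢ u
odd∸1≢odd (suc k) u ov ou refl with () ← trans (sym (odd-suc⇒even k ov)) ou

2∣n+n : ∀ n → 2 ∣ n + n
2∣n+n n = divides n (trans (cong (n +_) (sym (+-identityʳ n))) (*-comm 2 n))

-- Finite sums over lists

∑ : List A → (A → ℕ) → ℕ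
∑ []       f = 0
∑ (x ∷ xs) f = f x + ∑ xs f

syntax ∑ xs (λ x → e) = ∑[ x ∈ xs ] e

∑-cong : ∀ (xs : List A) {f g : A → ℕ} → (∀ x → f x ≡ g x) → ∑ xs f ≡ ∑ xs g
∑-cong []       _ = refl
∑-cong (x ∷ xs) e = cong₂ _+_ (e x) (∑-cong xs e)

∑-++ : ∀ (xs ys : List A) (f : A → ℕ) → ∑ (xs ++ ys) f ≡ ∑ xs f + ∑ ys f
∑-++ []       ys f = refl
∑-++ (x ∷ xs) ys f rewrite ∑-++ xs ys f = sym (+-assoc (f x) _ _)

∑-concatMap : ∀ {g : A → List B} (xs : List A) (f : B → ℕ) →
  ∑ (concatMap g xs) f ≡ ∑[ x ∈ xs ] ∑ (g x) f
∑-concatMap []               f = refl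
∑-concatMap {g = g} (x ∷ xs) f
  rewrite ∑-++ (g x) (concatMap g xs) f | ∑-concatMap {g = g} xs f = refl

∑-map : ∀ (g : A → B) (xs : List A) (f : B → ℕ) → ∑ (map g xs) f ≡ ∑[ x ∈ xs ] f (g x)
∑-map g []       f = refl
∑-map g (x ∷ xs) f = cong (f (g x) +_) (∑-map g xs f)

∑-+ : ∀ (xs : List A) (f g : A → ℕ) → ∑[ x ∈ xs ] (f x + g x) ≡ ∑ xs f + ∑ xs g
∑-+ []       f g = refl
∑-+ (x ∷ xs) f g rewrite ∑-+ xs f g = +-interchange (f x) (g x) (∑ xs f) (∑ xs g)

∑-cartesianProduct : ∀ (xs : List A) (ys : List B) (f : A × B → ℕ) →
  ∑ (cartesianProduct xs ys) f ≡ ∑[ x ∈ xs ] ∑[ y ∈ ys ] f (x , y)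
∑-cartesianProduct []       ys f = refl
∑-cartesianProduct (x ∷ xs) ys f = begin
  ∑ (map (x ,_) ys ++ cartesianProduct xs ys) f
    ≡⟨ ∑-++ (map (x ,_) ys) _ f ⟩
  ∑ (map (x ,_) ys) f + ∑ (cartesianProduct xs ys) f
    ≡⟨ cong₂ _+_ (∑-map (x ,_) ys f) (∑-cartesianProduct xs ys f) ⟩
  ∑[ y ∈ ys ] f (x , y) + ∑[ x′ ∈ xs ] ∑[ y ∈ ys ] f (x′ , y) ∎
  where open ≡-Reasoning

∑-upTo-extend : ∀ (f : ℕ → ℕ) {k N} → k ≤ N → (∀ v → k ≤ v → f v ≡ 0) →
  ∑ (upTo k) f ≡ ∑ (upTo N) f
∑-upTo-extend f {N = zero}  z≤n     _ = refl
∑-upTo-extend f {k} {suc N} k≤1+N vanish with m≤n⇒m<n∨m≡n k≤1+N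
... | inj₂ refl      = refl
... | inj₁ (s≤s k≤N) = begin
  ∑ (upTo k) f             ≡⟨ ∑-upTo-extend f k≤N vanish ⟩
  ∑ (upTo N) f             ≡⟨ sym (+-identityʳ _) ⟩
  ∑ (upTo N) f + 0         ≡⟨ cong (∑ (upTo N) f +_) (sym (trans (+-identityʳ (f N)) (vanish N k≤N))) ⟩
  ∑ (upTo N) f + (f N + 0) ≡⟨ sym (∑-++ (upTo N) [ N ] f) ⟩
  ∑ (upTo N ++ [ N ]) f    ≡⟨ cong (λ l → ∑ l f) (upTo-∷ʳ N) ⟩
  ∑ (upTo (suc N)) f       ∎
  where open ≡-Reasoning

∑-if-[] : ∀ b (y : A) (f : A → ℕ) → ∑ (if b then [ y ] else []) f ≡ (if b then f y else 0)
∑-if-[] true  y f = +-identityʳ (f y)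
∑-if-[] false y f = refl

if-∑ : ∀ b (xs : List A) (f : A → ℕ) → (if b then ∑ xs f else 0) ≡ ∑[ x ∈ xs ] (if b then f x else 0)
if-∑ true  xs f = refl
if-∑ false []       f = refl
if-∑ false (x ∷ xs) f = if-∑ false xs f

∑-even : ∀ {P : A → Set} {xs : List A} (f : A → ℕ) → (∀ {x} → P x → 2 ∣ f x) → All P xs → 2 ∣ ∑ xs f
∑-even f even All.[]         = divides 0 refl
∑-even f even (px All.∷ pxs) = ∣m∣n⇒∣m+n (even px) (∑-even f even pxs)

∑∑-symmetric-even : ∀ (xs : List A) (h : A → A → ℕ) → (∀ x → h x x ≡ 0) → (∀ x y → h x y ≡ h y x) →
  2 ∣ ∑[ x ∈ xs ] ∑[ y ∈ xs ] h x y
∑∑-symmetric-even []       h diag sym-h = divides 0 refl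
∑∑-symmetric-even (x ∷ xs) h diag sym-h = subst (2 ∣_) (sym split)
  (∣m∣n⇒∣m+n (2∣n+n (∑ xs (h x))) (∑∑-symmetric-even xs h diag sym-h))
  where
  open ≡-Reasoning
  row rest : ℕ
  row = ∑ xs (h x)
  rest = ∑[ y ∈ xs ] ∑ xs (h y)
  split : h x x + row + ∑[ y ∈ xs ] (h y x + ∑ xs (h y)) ≡ row + row + rest
  split = begin
    h x x + row + ∑[ y ∈ xs ] (h y x + ∑ xs (h y))
      ≡⟨ cong₂ (λ a b → a + row + b) (diag x) (∑-+ xs (λ y → h y x) (λ y → ∑ xs (h y))) ⟩
    row + (∑[ y ∈ xs ] h y x + rest)
      ≡⟨ cong (λ s → row + (s + rest)) (∑-cong xs (λ y → sym-h y x)) ⟩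
    row + (row + rest)
      ≡⟨ sym (+-assoc row row rest) ⟩
    row + row + rest ∎

multiplicity-∑ : ∀ {r c} (U : Array r c) (xs : Chain r c) →
  multiplicity U xs ≡ ∑[ y ∈ xs ] multiplicity U [ y ]
multiplicity-∑ U []       = refl
multiplicity-∑ U (x ∷ xs) = cong₂ _+_ (sym (+-identityʳ _)) (multiplicity-∑ U xs)

multiplicity-concatMap : ∀ {r c} (U : Array r c) (f : A → Chain r c) (xs : List A) →
  multiplicity U (concatMap f xs) ≡ ∑[ x ∈ xs ] multiplicity U (f x)
multiplicity-concatMap U f xs = begin
  multiplicity U (concatMap f xs)
    ≡⟨ multiplicity-∑ U (concatMap f xs) ⟩
  ∑[ y ∈ concatMap f xs ] multiplicity U [ y ]
    ≡⟨ ∑-concatMap xs _ ⟩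
  ∑[ x ∈ xs ] ∑[ y ∈ f x ] multiplicity U [ y ]
    ≡⟨ ∑-cong xs (λ x → sym (multiplicity-∑ U (f x))) ⟩
  ∑[ x ∈ xs ] multiplicity U (f x) ∎
  where open ≡-Reasoning

multiplicity-d∘d : ∀ {r c} (U : Array r c) (xs : Chain r c) →
  multiplicity U (d (d xs)) ≡ ∑[ T ∈ xs ] multiplicity U (d (dBasis T))
multiplicity-d∘d U xs = begin
  multiplicity U (concatMap dBasis (concatMap dBasis xs))
    ≡⟨ multiplicity-concatMap U dBasis (concatMap dBasis xs) ⟩
  ∑[ y ∈ concatMap dBasis xs ] multiplicity U (dBasis y)
    ≡⟨ ∑-concatMap xs _ ⟩
  ∑[ T ∈ xs ] ∑[ y ∈ dBasis T ] multiplicity U (dBasis y)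
    ≡⟨ ∑-cong xs (λ T → sym (multiplicity-concatMap U dBasis (dBasis T))) ⟩
  ∑[ T ∈ xs ] multiplicity U (d (dBasis T)) ∎
  where open ≡-Reasoning

-- Operations on a single row

≡ᵇ-reflects : ∀ m n → Reflects (m ≡ n) (m ≡ᵇ n)
≡ᵇ-reflects m n = proof (m ℕ.≟ n)

≡ᵇ-refl : ∀ n → (n ≡ᵇ n) ≡ true
≡ᵇ-refl n = dec-true (n ℕ.≟ n) refl

≢⇒≡ᵇ≡false : ∀ {m n} → m ≢ n → (m ≡ᵇ n) ≡ false
≢⇒≡ᵇ≡false {m} {n} = dec-false (m ℕ.≟ n)

occ-replaceFirst-≢ : ∀ {c v v′ w} (x : Vec ℕ c) → w ≢ v → v′ ≢ v →
  occ v (replaceFirst v′ w x) ≡ occ v x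
occ-replaceFirst-≢ [] _ _ = refl
occ-replaceFirst-≢ {v′ = v′} (x ∷ xs) w≢v v′≢v with x ≡ᵇ v′ | ≡ᵇ-reflects x v′
... | true  | ofʸ refl rewrite ≢⇒≡ᵇ≡false w≢v | ≢⇒≡ᵇ≡false v′≢v = refl
... | false | ofⁿ _    = cong (_ +_) (occ-replaceFirst-≢ xs w≢v v′≢v)

occFreeBelow-replaceFirst-≢ : ∀ {c v v′ w} (a x : Vec ℕ c) → w ≢ v → v′ ≢ v →
  occFreeBelow v a (replaceFirst v′ w x) ≡ occFreeBelow v a x
occFreeBelow-replaceFirst-≢ [] [] _ _ = refl
occFreeBelow-replaceFirst-≢ {v′ = v′} (a ∷ as) (x ∷ xs) w≢v v′≢v with x ≡ᵇ v′ | ≡ᵇ-reflects x v′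
... | true  | ofʸ refl rewrite ≢⇒≡ᵇ≡false w≢v | ≢⇒≡ᵇ≡false v′≢v = refl
... | false | ofⁿ _    = cong (_ +_) (occFreeBelow-replaceFirst-≢ as xs w≢v v′≢v)

occ-replaceFirst : ∀ {c v w} (x : Vec ℕ c) → w ≢ v → 0 < occ v x →
  suc (occ v (replaceFirst v w x)) ≡ occ v x
occ-replaceFirst {v = v} (x ∷ xs) w≢v pos with x ≡ᵇ v | ≡ᵇ-reflects x v
... | true  | ofʸ refl rewrite ≢⇒≡ᵇ≡false w≢v = refl
... | false | ofⁿ x≢v rewrite ≢⇒≡ᵇ≡false x≢v = occ-replaceFirst xs w≢v pos

occFreeBelow-≡0 : ∀ {c v} {a x : Vec ℕ c} → AllV (v ∸ 1 ≤_) a → Pointwise _<_ a x →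
  occFreeBelow v a x ≡ 0
occFreeBelow-≡0 [] [] = refl
occFreeBelow-≡0 {v = v} {a ∷ as} {x ∷ xs} (v∸1≤a ∷ v∸1≤as) (a<x ∷ as<xs)
  with x ≡ᵇ v | ≡ᵇ-reflects x v
... | false | _ = occFreeBelow-≡0 v∸1≤as as<xs
... | true  | ofʸ refl with a ≡ᵇ (x ∸ 1) | ≡ᵇ-reflects a (x ∸ 1)
...   | true  | _         = occFreeBelow-≡0 v∸1≤as as<xs
...   | false | ofⁿ a≢x∸1 = contradiction (≤-antisym (<⇒≤pred a<x) v∸1≤a) a≢x∸1

occFreeBelow-replaceFirst : ∀ {c v w} (a x : Vec ℕ c) → w ≢ v → AllPairs _≤_ a → Pointwise _<_ a x →
  0 < occFreeBelow v a x → suc (occFreeBelow v a (replaceFirst v w x)) ≡ occFreeBelow v a x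
occFreeBelow-replaceFirst {v = v} (a ∷ as) (x ∷ xs) w≢v (a≤as ∷ as↑) (a<x ∷ as<xs) pos
  with x ≡ᵇ v | ≡ᵇ-reflects x v
... | false | ofⁿ x≢v rewrite ≢⇒≡ᵇ≡false x≢v = occFreeBelow-replaceFirst as xs w≢v as↑ as<xs pos
... | true  | ofʸ refl with a ≡ᵇ (x ∸ 1) | ≡ᵇ-reflects a (x ∸ 1)
...   | true  | ofʸ refl = contradiction (occFreeBelow-≡0 a≤as as<xs) (≢-sym (<⇒≢ pos))
...   | false | ofⁿ _ rewrite ≢⇒≡ᵇ≡false w≢v = refl

occFreeBelow-replaceFirst-above : ∀ {c v v′} (a x : Vec ℕ c) → 1 ≤ v′ → v′ ≢ v ∸ 1 → Pointwise _<_ a x →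
  occFreeBelow v (replaceFirst v′ (v′ ∸ 1) a) x ≡ occFreeBelow v a x
occFreeBelow-replaceFirst-above [] [] _ _ _ = refl
occFreeBelow-replaceFirst-above {v = v} {v′} (a ∷ as) (x ∷ xs) 1≤v′ v′≢v∸1 (a<x ∷ as<xs)
  with a ≡ᵇ v′ | ≡ᵇ-reflects a v′
... | false | _ = cong (_ +_) (occFreeBelow-replaceFirst-above as xs 1≤v′ v′≢v∸1 as<xs)
... | true  | ofʸ refl with x ≡ᵇ v | ≡ᵇ-reflects x v
...   | false | _ = refl
...   | true  | ofʸ refl
  rewrite ≢⇒≡ᵇ≡false v′≢v∸1 | ≢⇒≡ᵇ≡false (<⇒≢ (∸-monoˡ-< a<x 1≤v′)) = refl

occFreeBelow≤occ : ∀ {c} v (a x : Vec ℕ c) → occFreeBelow v a x ≤ occ v x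
occFreeBelow≤occ v [] [] = z≤n
occFreeBelow≤occ v (a ∷ as) (x ∷ xs) with x ≡ᵇ v | a ≡ᵇ (v ∸ 1)
... | false | _     = occFreeBelow≤occ v as xs
... | true  | true  = m≤n⇒m≤1+n (occFreeBelow≤occ v as xs)
... | true  | false = s≤s (occFreeBelow≤occ v as xs)

occ-rowMax : ∀ {c v} (x : Vec ℕ c) → rowMax x < v → occ v x ≡ 0
occ-rowMax []       _ = refl
occ-rowMax (x ∷ xs) h = cong₂ _+_
  (cong (λ b → if b then 1 else 0) (≢⇒≡ᵇ≡false (<⇒≢ (≤-<-trans (m≤m⊔n x (rowMax xs)) h))))
  (occ-rowMax xs (≤-<-trans (m≤n⊔m x (rowMax xs)) h))

rowMax-< : ∀ {c N} {x : Vec ℕ c} → AllV (_< N) x → 0 < N → rowMax x < N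
rowMax-< []           0<N = 0<N
rowMax-< (x<N ∷ xs<N) 0<N = ⊔-lub x<N (rowMax-< xs<N 0<N)

replaceFirst-All : ∀ {c v w} {P : ℕ → Set} {x : Vec ℕ c} → AllV P x → (P v → P w) →
  AllV P (replaceFirst v w x)
replaceFirst-All [] _ = []
replaceFirst-All {v = v} {x = x ∷ xs} (px ∷ pxs) Pv⇒Pw with x ≡ᵇ v | ≡ᵇ-reflects x v
... | true  | ofʸ refl = Pv⇒Pw px ∷ pxs
... | false | _        = px ∷ replaceFirst-All pxs Pv⇒Pw

replaceFirst-comm : ∀ {c v₁ w₁ v₂ w₂} (x : Vec ℕ c) → v₁ ≢ v₂ → w₁ ≢ v₂ → w₂ ≢ v₁ →
  replaceFirst v₂ w₂ (replaceFirst v₁ w₁ x) ≡ replaceFirst v₁ w₁ (replaceFirst v₂ w₂ x)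
replaceFirst-comm [] _ _ _ = refl
replaceFirst-comm {v₁ = v₁} {v₂ = v₂} (x ∷ xs) v₁≢v₂ w₁≢v₂ w₂≢v₁
  with x ≡ᵇ v₁ | ≡ᵇ-reflects x v₁ | x ≡ᵇ v₂ | ≡ᵇ-reflects x v₂
... | true  | ofʸ refl | true  | ofʸ refl = contradiction refl v₁≢v₂
... | true  | ofʸ refl | false | _        rewrite ≢⇒≡ᵇ≡false w₁≢v₂ | ≡ᵇ-refl x = refl
... | false | ofⁿ x≢v₁ | true  | ofʸ refl rewrite ≢⇒≡ᵇ≡false w₂≢v₁ | ≡ᵇ-refl x = refl
... | false | ofⁿ x≢v₁ | false | ofⁿ x≢v₂ rewrite ≢⇒≡ᵇ≡false x≢v₁ | ≢⇒≡ᵇ≡false x≢v₂ =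
  cong (x ∷_) (replaceFirst-comm xs v₁≢v₂ w₁≢v₂ w₂≢v₁)

-- Lowering moves on a tableau

Move : ℕ → Set
Move r = Fin r × ℕ

lowerable : ∀ {r c} → Array r c → Move r → Bool
lowerable T (R , v) = isOdd v ∧ isOdd (freeCount (above T R) (lookup T R) v)

lower : ∀ {r c} → Array r c → Move r → Array r c
lower T (R , v) = T [ R ]≔ replaceFirst v (v ∸ 1) (lookup T R)

moves : (r N : ℕ) → List (Move r)
moves r N = cartesianProduct (allFin r) (upTo N)

Bounded : ∀ {r c} → ℕ → Array r c → Set
Bounded N T = AllV (AllV (_< N)) T

RowsSorted : ∀ {r c} → Array r c → Set
RowsSorted {r} T = (R : Fin r) → AllPairs _≤_ (lookup T R)

ColumnsStrict : ∀ {n c} → Array (suc n) c → Set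
ColumnsStrict {n} T = (i : Fin n) → Pointwise _<_ (lookup T (inject₁ i)) (lookup T (suc i))

IsSSYT⇒Bounded : ∀ {r c t} (T : Array r c) → IsSSYT r c t T → Bounded (r + t) T
IsSSYT⇒Bounded T (bounded , _ , _) = lookup⁻ (λ R → lookup⁻ (bounded R))

IsSSYT⇒RowsSorted : ∀ {r c t} (T : Array r c) → IsSSYT r c t T → RowsSorted T
IsSSYT⇒RowsSorted T (_ , rows , _) R = sorted⇒AllPairs (rows R)
  where
  sorted⇒AllPairs : ∀ {c} {x : Vec ℕ c} → (∀ j j′ → j Fin.≤ j′ → lookup x j ≤ lookup x j′) →
    AllPairs _≤_ x
  sorted⇒AllPairs {x = []}    _      = []
  sorted⇒AllPairs {x = _ ∷ _} sorted =
    lookup⁻ (λ j → sorted zero (suc j) z≤n)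
      ∷ sorted⇒AllPairs (λ j j′ j≤j′ → sorted (suc j) (suc j′) (s≤s j≤j′))

IsSSYT⇒ColumnsStrict : ∀ {n c t} (T : Array (suc n) c) → IsSSYT (suc n) c t T → ColumnsStrict T
IsSSYT⇒ColumnsStrict T (_ , _ , columns) i =
  extensional⇒inductive (ext (λ j → columns (inject₁ i) (suc i) j (≤̄⇒inject₁< ≤ᶠ-refl)))

All-[]≔ : ∀ {n} {P : A → Set} {xs : Vec A n} {y : A} (i : Fin n) → AllV P xs → P y → AllV P (xs [ i ]≔ y)
All-[]≔ zero    (_  ∷ pxs) py = py ∷ pxs
All-[]≔ (suc i) (px ∷ pxs) py = px ∷ All-[]≔ i pxs py

lower-Bounded : ∀ {r c N} {T : Array r c} → Bounded N T → ∀ p → Bounded N (lower T p)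
lower-Bounded bd (R , v) = All-[]≔ R bd (replaceFirst-All (lookup⁺ bd R) (≤-<-trans (m∸n≤m v 1)))

freeCount≤occ : ∀ {c} (ab : Maybe (Vec ℕ c)) row v → freeCount ab row v ≤ occ v row
freeCount≤occ nothing  row v = ≤-refl
freeCount≤occ (just a) row v = occFreeBelow≤occ v a row

lowerable-rowMax : ∀ {r c} (T : Array r c) R {v} → rowMax (lookup T R) < v → lowerable T (R , v) ≡ false
lowerable-rowMax T R {v} rowMax<v = trans (cong (λ n → isOdd v ∧ isOdd n) noneFree) (∧-zeroʳ (isOdd v))
  where
  noneFree : freeCount (above T R) (lookup T R) v ≡ 0
  noneFree = n≤0⇒n≡0 (subst (freeCount (above T R) (lookup T R) v ≤_)
    (occ-rowMax (lookup T R) rowMax<v) (freeCount≤occ (above T R) (lookup T R) v))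

-- dBasis lets v range up to the row maximum, which lowering can decrease; a
-- common bound N on the entries lets T and all its lowerings share one index list.
∑-dBasis : ∀ {r c N} (T : Array r c) (φ : Array r c → ℕ) → Bounded N T → 0 < N →
  ∑ (dBasis T) φ ≡ ∑[ p ∈ moves r N ] (if lowerable T p then φ (lower T p) else 0)
∑-dBasis {r} {c} {N} T φ bd 0<N = begin
  ∑ (dBasis T) φ
    ≡⟨ ∑-concatMap (allFin r) φ ⟩
  ∑[ R ∈ allFin r ] ∑ (concatMap (lowered R) (upTo (suc (rowMax (lookup T R))))) φ
    ≡⟨ ∑-cong (allFin r) row ⟩
  ∑[ R ∈ allFin r ] ∑[ v ∈ upTo N ] term (R , v)
    ≡⟨ sym (∑-cartesianProduct (allFin r) (upTo N) term) ⟩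
  ∑ (moves r N) term ∎
  where
  open ≡-Reasoning
  lowered : Fin r → ℕ → List (Array r c)
  lowered R v = if lowerable T (R , v) then [ lower T (R , v) ] else []
  term : Move r → ℕ
  term p = if lowerable T p then φ (lower T p) else 0
  row : ∀ R → ∑ (concatMap (lowered R) (upTo (suc (rowMax (lookup T R))))) φ
    ≡ ∑[ v ∈ upTo N ] term (R , v)
  row R = begin
    ∑ (concatMap (lowered R) (upTo (suc (rowMax (lookup T R))))) φ
      ≡⟨ ∑-concatMap {g = lowered R} (upTo (suc (rowMax (lookup T R)))) φ ⟩
    ∑[ v ∈ upTo (suc (rowMax (lookup T R))) ] ∑ (lowered R v) φ
      ≡⟨ ∑-cong (upTo (suc (rowMax (lookup T R)))) (λ v → ∑-if-[] (lowerable T (R , v)) (lower T (R , v)) φ) ⟩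
    ∑[ v ∈ upTo (suc (rowMax (lookup T R))) ] term (R , v)
      ≡⟨ ∑-upTo-extend (λ v → term (R , v)) (rowMax-< (lookup⁺ bd R) 0<N)
           (λ v rowMax<v → cong (λ b → if b then φ (lower T (R , v)) else 0) (lowerable-rowMax T R rowMax<v)) ⟩
    ∑[ v ∈ upTo N ] term (R , v) ∎

above-suc : ∀ {n c} (T : Array (suc n) c) i → above T (suc i) ≡ just (lookup T (inject₁ i))
above-suc (_ ∷ _) i = refl

above-[]≔ : ∀ {n c} (T : Array (suc n) c) R row i → inject₁ i ≢ R →
  above (T [ R ]≔ row) (suc i) ≡ above T (suc i)
above-[]≔ T R row i i≢R = begin
  above (T [ R ]≔ row) (suc i)             ≡⟨ above-suc (T [ R ]≔ row) i ⟩
  just (lookup (T [ R ]≔ row) (inject₁ i)) ≡⟨ cong just (lookup∘update′ i≢R T row) ⟩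
  just (lookup T (inject₁ i))              ≡⟨ sym (above-suc T i) ⟩
  above T (suc i)                          ∎
  where open ≡-Reasoning

above-[]≔-self : ∀ {n c} (T : Array (suc n) c) R row → above (T [ R ]≔ row) R ≡ above T R
above-[]≔-self T zero    row = refl
above-[]≔-self T (suc i) row = above-[]≔ T (suc i) row i (<⇒≢ᶠ (≤̄⇒inject₁< ≤ᶠ-refl))

freeCount-replaceFirst-≢ : ∀ {c} (ab : Maybe (Vec ℕ c)) row {v v′ w} → w ≢ v → v′ ≢ v →
  freeCount ab (replaceFirst v′ w row) v ≡ freeCount ab row v
freeCount-replaceFirst-≢ nothing  row = occ-replaceFirst-≢ row
freeCount-replaceFirst-≢ (just a) row = occFreeBelow-replaceFirst-≢ a row

freeCount-replaceFirst : ∀ {n c} (T : Array (suc n) c) → RowsSorted T → ColumnsStrict T →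
  ∀ R {v w} → w ≢ v → 0 < freeCount (above T R) (lookup T R) v →
  suc (freeCount (above T R) (replaceFirst v w (lookup T R)) v) ≡ freeCount (above T R) (lookup T R) v
freeCount-replaceFirst T sorted strict zero    w≢v = occ-replaceFirst (lookup T zero) w≢v
freeCount-replaceFirst T sorted strict (suc i) w≢v rewrite above-suc T i =
  occFreeBelow-replaceFirst (lookup T (inject₁ i)) (lookup T (suc i)) w≢v (sorted (inject₁ i)) (strict i)

freeCount-above-lower : ∀ {n c} (T : Array (suc n) c) → ColumnsStrict T → ∀ R₁ v₁ R v →
  isOdd v₁ ≡ true → isOdd v ≡ true →
  freeCount (above (lower T (R₁ , v₁)) R) (lookup T R) v ≡ freeCount (above T R) (lookup T R) v
freeCount-above-lower T strict R₁ v₁ zero    v odd₁ odd = refl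
freeCount-above-lower T strict R₁ v₁ (suc i) v odd₁ odd with inject₁ i Fin.≟ R₁
... | no i≢R₁ = cong (λ ab → freeCount ab (lookup T (suc i)) v) (above-[]≔ T R₁ _ i i≢R₁)
... | yes refl
  rewrite above-suc (lower T (inject₁ i , v₁)) i | above-suc T i
        | lookup∘update (inject₁ i) T (replaceFirst v₁ (v₁ ∸ 1) (lookup T (inject₁ i))) =
  occFreeBelow-replaceFirst-above (lookup T (inject₁ i)) (lookup T (suc i))
    (odd⇒nonZero v₁ odd₁) (≢-sym (odd∸1≢odd v v₁ odd odd₁)) (strict i)

lowerable-lower-self : ∀ {n c} (T : Array (suc n) c) → RowsSorted T → ColumnsStrict T →
  ∀ p → lowerable T p ≡ true → lowerable (lower T p) p ≡ false
lowerable-lower-self T sorted strict (R , v) h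
  rewrite lookup∘update R T (replaceFirst v (v ∸ 1) (lookup T R))
        | above-[]≔-self T R (replaceFirst v (v ∸ 1) (lookup T R)) =
  trans (cong (isOdd v ∧_) evenAfter) (∧-zeroʳ (isOdd v))
  where
  free free′ : ℕ
  free  = freeCount (above T R) (lookup T R) v
  free′ = freeCount (above T R) (replaceFirst v (v ∸ 1) (lookup T R)) v
  oddV : isOdd v ≡ true
  oddV = ∧-conicalˡ _ _ h
  oddFree : isOdd free ≡ true
  oddFree = ∧-conicalʳ _ _ h
  dropsByOne : suc free′ ≡ free
  dropsByOne = freeCount-replaceFirst T sorted strict R (odd∸1≢odd v v oddV oddV) (odd⇒nonZero free oddFree)
  evenAfter : isOdd free′ ≡ false
  evenAfter = odd-suc⇒even free′ (trans (cong isOdd dropsByOne) oddFree)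

lowerable-lower-≢ : ∀ {n c} (T : Array (suc n) c) → ColumnsStrict T →
  ∀ {p} q → lowerable T p ≡ true → q ≢ p → lowerable (lower T p) q ≡ lowerable T q
lowerable-lower-≢ T strict {R₁ , v₁} (R , v) h q≢p with isOdd v in odd
... | false = refl
... | true with R Fin.≟ R₁
...   | no R≢R₁ rewrite lookup∘update′ R≢R₁ T (replaceFirst v₁ (v₁ ∸ 1) (lookup T R₁)) =
  cong isOdd (freeCount-above-lower T strict R₁ v₁ R v (∧-conicalˡ _ _ h) odd)
...   | yes refl
  rewrite lookup∘update R T (replaceFirst v₁ (v₁ ∸ 1) (lookup T R))
        | above-[]≔-self T R (replaceFirst v₁ (v₁ ∸ 1) (lookup T R)) =
  cong isOdd (freeCount-replaceFirst-≢ (above T R) (lookup T R)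
    (odd∸1≢odd v₁ v (∧-conicalˡ _ _ h) odd) (λ v₁≡v → q≢p (cong (R ,_) (sym v₁≡v))))

lower-lower-sameRow : ∀ {r c} (T : Array r c) R v₁ v₂ →
  lower (lower T (R , v₁)) (R , v₂)
    ≡ T [ R ]≔ replaceFirst v₂ (v₂ ∸ 1) (replaceFirst v₁ (v₁ ∸ 1) (lookup T R))
lower-lower-sameRow T R v₁ v₂ rewrite lookup∘update R T (replaceFirst v₁ (v₁ ∸ 1) (lookup T R)) =
  []≔-idempotent T R

lower-comm : ∀ {r c} (T : Array r c) {p q} → isOdd (proj₂ p) ≡ true → isOdd (proj₂ q) ≡ true → p ≢ q →
  lower (lower T p) q ≡ lower (lower T q) p
lower-comm T {R₁ , v₁} {R₂ , v₂} odd₁ odd₂ p≢q with R₁ Fin.≟ R₂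
... | no R₁≢R₂
  rewrite lookup∘update′ (≢-sym R₁≢R₂) T (replaceFirst v₁ (v₁ ∸ 1) (lookup T R₁))
        | lookup∘update′ R₁≢R₂ T (replaceFirst v₂ (v₂ ∸ 1) (lookup T R₂)) =
  []≔-commutes T R₁ R₂ R₁≢R₂
... | yes refl = begin
  lower (lower T (R₁ , v₁)) (R₁ , v₂)
    ≡⟨ lower-lower-sameRow T R₁ v₁ v₂ ⟩
  T [ R₁ ]≔ replaceFirst v₂ (v₂ ∸ 1) (replaceFirst v₁ (v₁ ∸ 1) (lookup T R₁))
    ≡⟨ cong (T [ R₁ ]≔_) (replaceFirst-comm (lookup T R₁) (λ v₁≡v₂ → p≢q (cong (R₁ ,_) v₁≡v₂))
         (odd∸1≢odd v₁ v₂ odd₁ odd₂) (odd∸1≢odd v₂ v₁ odd₂ odd₁)) ⟩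
  T [ R₁ ]≔ replaceFirst v₁ (v₁ ∸ 1) (replaceFirst v₂ (v₂ ∸ 1) (lookup T R₁))
    ≡⟨ sym (lower-lower-sameRow T R₁ v₂ v₁) ⟩
  lower (lower T (R₁ , v₂)) (R₁ , v₁) ∎
  where open ≡-Reasoning

ddTerm : ∀ {r c} → Array r c → Array r c → Move r → Move r → ℕ
ddTerm U T p q =
  if lowerable T p then (if lowerable (lower T p) q then multiplicity U [ lower (lower T p) q ] else 0) else 0

multiplicity-d∘dBasis : ∀ {r c N} (U T : Array r c) → Bounded N T → 0 < N →
  multiplicity U (d (dBasis T)) ≡ ∑[ p ∈ moves r N ] ∑[ q ∈ moves r N ] ddTerm U T p q
multiplicity-d∘dBasis {r} {c} {N} U T bd 0<N = begin
  multiplicity U (d (dBasis T))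
    ≡⟨ multiplicity-concatMap U dBasis (dBasis T) ⟩
  ∑[ y ∈ dBasis T ] multiplicity U (dBasis y)
    ≡⟨ ∑-dBasis T (multiplicity U ∘ dBasis) bd 0<N ⟩
  ∑[ p ∈ moves r N ] (if lowerable T p then multiplicity U (dBasis (lower T p)) else 0)
    ≡⟨ ∑-cong (moves r N) (λ p → cong (λ m → if lowerable T p then m else 0) (second p)) ⟩
  ∑[ p ∈ moves r N ] (if lowerable T p then ∑ (moves r N) (term p) else 0)
    ≡⟨ ∑-cong (moves r N) (λ p → if-∑ (lowerable T p) (moves r N) (term p)) ⟩
  ∑[ p ∈ moves r N ] ∑[ q ∈ moves r N ] ddTerm U T p q ∎
  where
  open ≡-Reasoning
  term : Move r → Move r → ℕ
  term p q = if lowerable (lower T p) q then multiplicity U [ lower (lower T p) q ] else 0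
  second : ∀ p → multiplicity U (dBasis (lower T p)) ≡ ∑ (moves r N) (term p)
  second p = trans (multiplicity-∑ U (dBasis (lower T p)))
    (∑-dBasis (lower T p) (λ y → multiplicity U [ y ]) (lower-Bounded bd p) 0<N)

ddTerm-diagonal : ∀ {n c} (U T : Array (suc n) c) → RowsSorted T → ColumnsStrict T → ∀ p → ddTerm U T p p ≡ 0
ddTerm-diagonal U T sorted strict p with lowerable T p in h
... | false = refl
... | true rewrite lowerable-lower-self T sorted strict p h = refl

ddTerm-symmetric : ∀ {n c} (U T : Array (suc n) c) → ColumnsStrict T → ∀ p q → ddTerm U T p q ≡ ddTerm U T q p
ddTerm-symmetric U T strict p q with ×-≡-dec Fin._≟_ ℕ._≟_ p q
... | yes refl = refl
... | no p≢q with lowerable T p in hp | lowerable T q in hq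
...   | false | false = refl
...   | true  | false rewrite lowerable-lower-≢ T strict q hp (≢-sym p≢q) | hq = refl
...   | false | true  rewrite lowerable-lower-≢ T strict p hq p≢q | hp = refl
...   | true  | true
  rewrite lowerable-lower-≢ T strict q hp (≢-sym p≢q) | lowerable-lower-≢ T strict p hq p≢q | hp | hq =
  cong (λ V → multiplicity U [ V ]) (lower-comm T (∧-conicalˡ _ _ hp) (∧-conicalˡ _ _ hq) p≢q)

IsSSYT⇒d∘dBasis-even : ∀ {n c t} (U T : Array (suc n) c) → IsSSYT (suc n) c t T →
  2 ∣ multiplicity U (d (dBasis T))
IsSSYT⇒d∘dBasis-even {n} {t = t} U T ssyt =
  subst (2 ∣_) (sym (multiplicity-d∘dBasis U T (IsSSYT⇒Bounded T ssyt) (s≤s z≤n)))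
    (∑∑-symmetric-even (moves (suc n) (suc n + t)) (ddTerm U T)
      (ddTerm-diagonal U T (IsSSYT⇒RowsSorted T ssyt) (IsSSYT⇒ColumnsStrict T ssyt))
      (ddTerm-symmetric U T (IsSSYT⇒ColumnsStrict T ssyt)))

proposition5p1 : (r c t : ℕ) → r ≥ 1 → c ≥ 1 → t ≥ 1 →
    (x : Chain r c) → All (IsSSYT r c t) x → IsZeroChain (d (d x))
proposition5p1 (suc n) c t _ _ _ x ssyts U =
  n∣m⇒m%n≡0 _ 2 (subst (2 ∣_) (sym (multiplicity-d∘d U x))
    (∑-even (λ T → multiplicity U (d (dBasis T))) (λ {T} → IsSSYT⇒d∘dBasis-even U T) ssyts))
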